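{- Let $D$ be a strong digraph and assume there exist an arc $xy\in A(D)$ and two $(y,x)$-paths in $D$ that have no vertex in common other than $y$ and $x$. Then $D$ has a $2$-partition $(V_1,V_2)$ such that every vertex of $V_1$ has an out-neighbour in $V_2$ and every vertex of $V_2$ has an in-neighbour in $V_1$.
   Context: A digraph is strong if for every ordered pair $u,v$ of distinct vertices there is a directed $(u,v)$-path. A $(y,x)$-path is a directed path from $y$ to $x$. -}

module Defs where

open import Data.Nat using (ℕ)
open import Data.Fin using (Fin)
open import Data.Bool using (Bool; true; false)
open import Data.List using (List; []; _∷_; head; last)
open import Data.List.Relation.Unary.Unique.Propositional using (Unique)
open import Data.List.Membership.Propositional using (_∈_)
open import Data.Maybe using (Maybe; just)
open import Data.Product using (_×_; ∃-syntax; Σ-syntax)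
open import Data.Sum using (_⊎_)
open import Data.Empty using (⊥)
open import Relation.Binary.PropositionalEquality using (_≡_; _≢_)
open import Relation.Nullary using (¬_)

record Digraph : Set where
  field
    n     : ℕ
    adj   : Fin n → Fin n → Bool
    loopless : ∀ v → adj v v ≡ false

open Digraph public

V : Digraph → Set
V D = Fin (n D)

Arc : (D : Digraph) → V D → V D → Set
Arc D u v = adj D u v ≡ true

data Walk (D : Digraph) : List (V D) → Set where
  single : ∀ v → Walk D (v ∷ [])
  step   : ∀ {u v vs} → Arc D u v → Walk D (v ∷ vs) → Walk D (u ∷ v ∷ vs)

IsPath : (D : Digraph) → V D → V D → List (V D) → Set
IsPath D u v P = Walk D P × Unique P × head P ≡ just u × last P ≡ just v

Strong : Digraph → Set
Strong D = ∀ (u v : V D) → u ≢ v → ∃[ P ] IsPath D u v P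

InternallyDisjoint : (D : Digraph) → V D → V D → List (V D) → List (V D) → Set
InternallyDisjoint D y x P Q = ∀ w → w ∈ P → w ∈ Q → (w ≡ y ⊎ w ≡ x)

-- a 2-partition (V₁ , V₂) encoded by a colouring: V₁ = colour true,
-- V₂ = colour false; both parts non-empty.
InV₁ : {D : Digraph} → (V D → Bool) → V D → Set
InV₁ c v = c v ≡ true

InV₂ : {D : Digraph} → (V D → Bool) → V D → Set
InV₂ c v = c v ≡ false

Is2Partition : (D : Digraph) → (V D → Bool) → Set
Is2Partition D c = (∃[ v ] InV₁ {D} c v) × (∃[ v ] InV₂ {D} c v)

module Submission where

-- Relative to
-- a vertex set U and a set R of vertices prescribed to V₂, a colouring is good
-- when R-vertices are false, every true vertex of U has a false out-neighbour
-- in U, and every false vertex of U outside R has a true in-neighbour in U;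
-- U is flexible when it has a good colouring for every R.
--
-- 1. Extension lemma: a flexible set stays flexible when we add a vertex with
--    an out-neighbour in it.  Growth lemma: in a strong digraph, a non-empty
--    flexible set therefore grows vertex by vertex to the whole vertex set.
-- 2. Theta lemma: the vertex set of the theta formed by the arc xy and the two
--    internally disjoint (y,x)-paths is flexible.  The internal vertices of
--    both paths are coloured greedily along the paths, and the colour of y and
--    the colours the two greedy runs start from are chosen by case analysis.
-- 3. Hence the whole vertex set is flexible, and a good colouring for R = ∅ is
--    the required 2-partition.

open import Defs
open import Data.Bool using (Bool; true; false; not; _∨_; if_then_else_)
open import Data.Bool.Properties using (∨-zeroʳ; not-injective)
open import Data.Empty using (⊥; ⊥-elim)
open import Data.Fin using () renaming (_≟_ to _≟ᶠ_)
open import Data.Fin.Properties using (any?)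
open import Data.Fin.Subset using (Subset; _-_; ∣_∣) renaming (_∈_ to _∈ₛ_; ⊤ to everyone)
open import Data.Fin.Subset.Properties using (∈⊤; ∣p∣≤n; x∈p∧x≢y⇒x∈p-y; x∈p⇒∣p-x∣<∣p∣)
open import Data.List using (List; []; _∷_; head; last)
open import Data.Maybe using (just)
open import Data.Nat using (zero; suc; _<_; s≤s; s≤s⁻¹)
open import Data.Nat.Properties using (<-≤-trans)
open import Data.Product using (_×_; _,_; proj₁; proj₂; ∃-syntax)
open import Function using (id; _∘_)
import Data.List.Relation.Unary.All as All
open import Data.List.Relation.Unary.Any using (here; there)
open import Data.List.Relation.Unary.AllPairs using ([]; _∷_)
open import Data.List.Relation.Unary.Unique.Propositional using (Unique)
open import Data.List.Membership.Propositional using (_∈_; _∉_)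
import Data.List.Membership.DecPropositional as DecMembership
open import Data.Sum using (_⊎_; inj₁; inj₂; map₂)
import Data.Sum as Sum
open import Data.Unit using (⊤; tt)
open import Relation.Nullary using (¬_; does; yes; no; ¬?; _⊎-dec_)
open import Relation.Nullary.Decidable using (decidable-stable)
open import Relation.Unary using (Decidable)
open import Relation.Binary.PropositionalEquality

clash : ∀ {b} → b ≡ true → b ≡ false → ⊥
clash refl ()

nor-left : ∀ {a} b → a ≡ true → not (a ∨ b) ≡ false
nor-left b refl = refl

nor-right : ∀ a {b} → b ≡ true → not (a ∨ b) ≡ false
nor-right a refl = cong not (∨-zeroʳ a)

or-true : ∀ a b → a ∨ b ≡ true → a ≡ true ⊎ b ≡ true
or-true true  _ _ = inj₁ refl
or-true false _ e = inj₂ e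

nor-false : ∀ a b → not (a ∨ b) ≡ false → a ≡ true ⊎ b ≡ true
nor-false a b e = or-true a b (not-injective e)

arc-distinct : ∀ D {u v} → Arc D u v → u ≢ v
arc-distinct D {u} uv refl = clash uv (loopless D u)

module Colourings (D : Digraph) where

  Colouring : Set
  Colouring = V D → Bool

  -- The two requirements of the theorem at a vertex v, relative to a vertex
  -- set U (witnesses must lie in U) and a set R of vertices that are
  -- prescribed to lie in V₂ (colour false); a vertex of R needs no in-neighbour.
  record GoodAt (U : V D → Set) (R : V D → Bool) (c : Colouring) (v : V D) : Set where
    field
      forced : R v ≡ true → c v ≡ false
      outNbr : c v ≡ true → ∃[ w ] (U w × c w ≡ false × Arc D v w)
      inNbr  : c v ≡ false → R v ≡ true ⊎ ∃[ u ] (U u × c u ≡ true × Arc D u v)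

  open GoodAt public

  Good : (V D → Set) → (V D → Bool) → Colouring → Set
  Good U R c = ∀ v → U v → GoodAt U R c v

  Flexible : (V D → Set) → Set
  Flexible U = ∀ R → ∃[ c ] Good U R c

  GoodAt-mono : ∀ {U U' R c v} → (∀ {w} → U w → U' w) → GoodAt U R c v → GoodAt U' R c v
  GoodAt-mono U⊆U' g = record
    { forced = forced g
    ; outNbr = λ cv → let (w , Uw , cw , vw) = outNbr g cv in w , U⊆U' Uw , cw , vw
    ; inNbr  = λ cv → map₂ (λ (u , Uu , cu , uv) → u , U⊆U' Uu , cu , uv) (inNbr g cv)
    }

  _[_≔_] : {B : Set} → (V D → B) → V D → B → V D → B
  (f [ a ≔ β ]) v = if does (v ≟ᶠ a) then β else f v

  ≔-here : ∀ {B} (f : V D → B) a β → (f [ a ≔ β ]) a ≡ β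
  ≔-here f a β with a ≟ᶠ a
  ... | yes _  = refl
  ... | no a≢a = ⊥-elim (a≢a refl)

  ≔-there : ∀ {B} (f : V D → B) {a v} β → v ≢ a → (f [ a ≔ β ]) v ≡ f v
  ≔-there f {a} {v} β v≢a with v ≟ᶠ a
  ... | yes v≡a = ⊥-elim (v≢a v≡a)
  ... | no _    = refl

  recolour : ∀ {U U' R R' c c' v} → (∀ {w} → U w → U' w) → (∀ {w} → U w → c' w ≡ c w) →
    U v → (R v ≡ true → R' v ≡ true) →
    (R' v ≡ true → R v ≡ true ⊎ ∃[ u ] (U' u × c' u ≡ true × Arc D u v)) →
    GoodAt U R' c v → GoodAt U' R c' v
  recolour {U} {U'} {R} {R'} {c} {c'} {v} U⊆U' agree Uv R⊆R' leaveR g = record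
    { forced = λ Rv → trans (agree Uv) (forced g (R⊆R' Rv))
    ; outNbr = λ c'v → let (w , Uw , cw , vw) = outNbr g (trans (sym (agree Uv)) c'v)
                       in w , U⊆U' Uw , trans (agree Uw) cw , vw
    ; inNbr  = λ c'v → inNbr' (inNbr g (trans (sym (agree Uv)) c'v))
    }
    where
      inNbr' : R' v ≡ true ⊎ ∃[ u ] (U u × c u ≡ true × Arc D u v) →
               R v ≡ true ⊎ ∃[ u ] (U' u × c' u ≡ true × Arc D u v)
      inNbr' (inj₁ R'v) = leaveR R'v
      inNbr' (inj₂ (u , Uu , cu , uv)) = inj₂ (u , U⊆U' Uu , trans (agree Uu) cu , uv)

  _+ᵛ_ : (V D → Set) → V D → V D → Set
  (U +ᵛ a) v = U v ⊎ v ≡ a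

  -- If a is prescribed to V₂ it is coloured false; otherwise it is
  -- coloured true and b is prescribed to V₂, which then has in-neighbour a.
  extend : ∀ {U a b} → ¬ U a → Arc D a b → U b → Flexible U → Flexible (U +ᵛ a)
  extend {U} {a} {b} a∉U ab Ub flexible R with R a in Ra
  ... | true = c' , good'
    where
      c c' : Colouring
      c  = proj₁ (flexible R)
      c' = c [ a ≔ false ]
      agree : ∀ {w} → U w → c' w ≡ c w
      agree Uw = ≔-there c false (λ { refl → a∉U Uw })
      good' : Good (U +ᵛ a) R c'
      good' v (inj₁ Uv) = recolour inj₁ agree Uv id inj₁ (proj₂ (flexible R) v Uv)
      good' v (inj₂ refl) = record
        { forced = λ _ → ≔-here c a false
        ; outNbr = λ c'a → ⊥-elim (clash c'a (≔-here c a false))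
        ; inNbr  = λ _ → inj₁ Ra
        }
  ... | false = c' , good'
    where
      R' : V D → Bool
      R' = R [ b ≔ true ]
      c c' : Colouring
      c  = proj₁ (flexible R')
      c' = c [ a ≔ true ]
      agree : ∀ {w} → U w → c' w ≡ c w
      agree Uw = ≔-there c true (λ { refl → a∉U Uw })
      shrink : ∀ {v} → R v ≡ true → R' v ≡ true
      shrink {v} Rv with v ≟ᶠ b
      ... | yes _ = refl
      ... | no _  = Rv
      leave : ∀ {v} → R' v ≡ true → R v ≡ true ⊎ ∃[ u ] ((U +ᵛ a) u × c' u ≡ true × Arc D u v)
      leave {v} R'v with v ≟ᶠ b
      ... | yes refl = inj₂ (a , inj₂ refl , ≔-here c a true , ab)
      ... | no _     = inj₁ R'v
      bInV₂ : c' b ≡ false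
      bInV₂ = trans (agree Ub) (forced (proj₂ (flexible R') b Ub) (≔-here R b true))
      good' : Good (U +ᵛ a) R c'
      good' v (inj₁ Uv) = recolour inj₁ agree Uv shrink leave (proj₂ (flexible R') v Uv)
      good' v (inj₂ refl) = record
        { forced = λ Ra' → ⊥-elim (clash Ra' Ra)
        ; outNbr = λ _ → b , inj₁ Ub , bInV₂ , ab
        ; inNbr  = λ c'a → ⊥-elim (clash (≔-here c a true) c'a)
        }

  entryArc : ∀ {U : V D → Set} → Decidable U → ∀ {L s t} → Walk D L →
    head L ≡ just s → last L ≡ just t → ¬ U s → U t → ∃[ a ] ∃[ b ] (¬ U a × U b × Arc D a b)
  entryArc U? (single _) refl refl ¬Us Ut = ⊥-elim (¬Us Ut)
  entryArc U? (step {u} {w} uw walk) refl lastL ¬Uu Ut with U? w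
  ... | yes Uw = u , w , ¬Uu , Uw , uw
  ... | no ¬Uw = entryArc U? walk refl lastL ¬Uw Ut

  -- In a strong digraph a flexible set containing t absorbs the remaining
  -- vertices one at a time (entryArc, extend); the vertices not yet absorbed
  -- lie in O, whose size bounds the recursion.
  absorb : Strong D → ∀ {t} k (O : Subset (n D)) → ∣ O ∣ < k →
    ∀ {U : V D → Set} → Decidable U → U t → (∀ v → v ∈ₛ O ⊎ U v) → Flexible U → Flexible (λ _ → ⊤)
  absorb _ zero _ ()
  absorb strong {t} (suc k) O |O|<k {U} U? Ut cover flexible with any? (λ v → ¬? (U? v))
  ... | no allInU = λ R → let (c , good) = flexible R in
          c , λ v _ → GoodAt-mono (λ _ → tt) (good v (decidable-stable (U? v) (λ ¬Uv → allInU (v , ¬Uv))))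
  ... | yes (s , ¬Us) with strong s t (λ { refl → ¬Us Ut })
  ...   | (_ , walk , _ , headP , lastP) with entryArc U? walk headP lastP ¬Us Ut
  ...     | (a , b , ¬Ua , Ub , ab) =
          absorb strong k (O - a) smaller (λ v → U? v ⊎-dec v ≟ᶠ a) (inj₁ Ut) cover'
                 (extend ¬Ua ab Ub flexible)
    where
      a∈O : a ∈ₛ O
      a∈O with cover a
      ... | inj₁ a∈O = a∈O
      ... | inj₂ Ua  = ⊥-elim (¬Ua Ua)
      smaller : ∣ O - a ∣ < k
      smaller = <-≤-trans (x∈p⇒∣p-x∣<∣p∣ a∈O) (s≤s⁻¹ |O|<k)
      cover' : ∀ v → v ∈ₛ O - a ⊎ (U +ᵛ a) v
      cover' v with v ≟ᶠ a
      ... | yes v≡a = inj₂ (inj₂ v≡a)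
      ... | no v≢a  = Sum.map (λ v∈O → x∈p∧x≢y⇒x∈p-y v∈O v≢a) inj₁ (cover v)

  grow : Strong D → ∀ {U : V D → Set} {t} → Decidable U → U t → Flexible U →
    Flexible (λ _ → ⊤)
  grow strong U? Ut =
    absorb strong (suc (n D)) everyone (s≤s (∣p∣≤n everyone)) U? Ut (λ _ → inj₁ ∈⊤)

-- A route from a to z with internal vertices L: the arcs a → L → z.
data Route (D : Digraph) : V D → List (V D) → V D → Set where
  direct : ∀ {a z} → Arc D a z → Route D a [] z
  via    : ∀ {a u L z} → Arc D a u → Route D u L z → Route D a (u ∷ L) z

-- Greedy colouring along a route, for a fixed prescription R: each internal
-- vertex goes to V₂ exactly when it is prescribed or its predecessor is in V₁.
module Greedy (D : Digraph) (R : V D → Bool) where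
  open Colourings D

  rule : Bool → V D → Bool
  rule b u = not (R u ∨ b)

  exit : Bool → List (V D) → Bool
  exit b []       = b
  exit b (u ∷ us) = exit (rule b u) us

  data Greedy (c : Colouring) : Bool → List (V D) → Set where
    []  : ∀ {b} → Greedy c b []
    _∷_ : ∀ {b u us} → c u ≡ rule b u → Greedy c (rule b u) us → Greedy c b (u ∷ us)

  Greedy-cong : ∀ {c c' b L} → (∀ {v} → v ∈ L → c' v ≡ c v) → Greedy c b L → Greedy c' b L
  Greedy-cong agree []       = []
  Greedy-cong agree (cu ∷ g) = trans (agree (here refl)) cu ∷ Greedy-cong (agree ∘ there) g

  greedyAlong : Bool → List (V D) → Colouring
  greedyAlong b []       = λ _ → false
  greedyAlong b (u ∷ us) = greedyAlong (rule b u) us [ u ≔ rule b u ]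

  greedyAlong-greedy : ∀ b {L} → Unique L → Greedy (greedyAlong b L) b L
  greedyAlong-greedy b {[]}     _             = []
  greedyAlong-greedy b {u ∷ us} (u∉us ∷ uniq) =
    ≔-here rest u (rule b u) ∷ Greedy-cong (λ v∈us → ≔-there rest _ (≢-sym (All.lookup u∉us v∈us)))
                               (greedyAlong-greedy (rule b u) uniq)
    where
      rest : Colouring
      rest = greedyAlong (rule b u) us

  OnRoute : V D → List (V D) → V D → V D → Set
  OnRoute a L z w = w ≡ a ⊎ w ∈ L ⊎ w ≡ z

  onRoute-tail : ∀ {a u L z w} → OnRoute u L z w → OnRoute a (u ∷ L) z w
  onRoute-tail (inj₁ refl)        = inj₂ (inj₁ (here refl))
  onRoute-tail (inj₂ (inj₁ w∈L)) = inj₂ (inj₁ (there w∈L))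
  onRoute-tail (inj₂ (inj₂ w≡z)) = inj₂ (inj₂ w≡z)

  firstOut : ∀ {c a L z b} → Route D a L z → Greedy c b L → (exit b L ≡ true → c z ≡ false) →
    b ≡ true → ∃[ w ] (OnRoute a L z w × c w ≡ false × Arc D a w)
  firstOut {z = z} (direct az) [] zFalse refl = z , inj₂ (inj₂ refl) , zFalse refl , az
  firstOut (via {u = u} au _) (cu ∷ _) _ refl =
    u , inj₂ (inj₁ (here refl)) , trans cu (nor-right (R u) refl) , au

  lastIn : ∀ {c a L z b} → Route D a L z → Greedy c b L → (b ≡ true → c a ≡ true) →
    exit b L ≡ true → ∃[ u ] (OnRoute a L z u × c u ≡ true × Arc D u z)
  lastIn {a = a} (direct az) [] aTrue e = a , inj₁ refl , aTrue e , az
  lastIn (via _ r) (cu ∷ g) _ e =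
    let (u , onR , cu' , uz) = lastIn r g (trans cu) e in u , onRoute-tail onR , cu' , uz

  internal : ∀ {c a L z b} → Route D a L z → Greedy c b L → (b ≡ true → c a ≡ true) →
    (exit b L ≡ true → c z ≡ false) → ∀ {v} → v ∈ L → GoodAt (OnRoute a L z) R c v
  internal {c} {a} {u ∷ L} {z} {b} (via au r) (cu ∷ g) aTrue zFalse (here refl) = record
    { forced = λ Ru → trans cu (nor-left b Ru)
    ; outNbr = λ cu≡true →
        let (w , onR , cw , uw) = firstOut r g zFalse (trans (sym cu) cu≡true)
        in w , onRoute-tail onR , cw , uw
    ; inNbr  = λ cu≡false → predecessor (nor-false (R u) b (trans (sym cu) cu≡false))
    }
    where
      predecessor : R u ≡ true ⊎ b ≡ true →
        R u ≡ true ⊎ ∃[ w ] (OnRoute a (u ∷ L) z w × c w ≡ true × Arc D w u)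
      predecessor (inj₁ Ru) = inj₁ Ru
      predecessor (inj₂ b≡true) = inj₂ (a , inj₁ refl , aTrue b≡true , au)
  internal (via _ r) (cu ∷ g) _ zFalse (there v∈L) =
    GoodAt-mono onRoute-tail (internal r g (trans cu) zFalse v∈L)

record Theta (D : Digraph) : Set where
  field
    x y      : V D
    backArc  : Arc D x y
    Pi Qi    : List (V D)
    routeP   : Route D y Pi x
    routeQ   : Route D y Qi x
    uniqueP  : Unique Pi
    uniqueQ  : Unique Qi
    y∉Pi     : y ∉ Pi
    x∉Pi     : x ∉ Pi
    y∉Qi     : y ∉ Qi
    x∉Qi     : x ∉ Qi
    disjoint : ∀ {v} → v ∈ Pi → v ∉ Qi

  InTheta : V D → Set
  InTheta v = v ≡ y ⊎ v ≡ x ⊎ v ∈ Pi ⊎ v ∈ Qi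

  inTheta? : Decidable InTheta
  inTheta? v = v ≟ᶠ y ⊎-dec v ≟ᶠ x ⊎-dec v ∈? Pi ⊎-dec v ∈? Qi
    where open DecMembership (_≟ᶠ_ {n D}) using (_∈?_)

  x≢y : x ≢ y
  x≢y = arc-distinct D backArc

-- The internal vertices of both routes
-- are coloured greedily; the colour of x is forced by its two predecessors, and
-- the colour of y and the two start colours are chosen by a case analysis.
module ThetaColouring {D : Digraph} (Θ : Theta D) (R : V D → Bool) where
  open Theta Θ
  open Colourings D
  open Greedy D R
  open DecMembership (_≟ᶠ_ {n D}) using (_∈?_)

  xColour : Bool → Bool → Bool
  xColour bP bQ = not (R x ∨ exit bP Pi ∨ exit bQ Qi)

  colour : Bool → Bool → Bool → Colouring
  colour cy bP bQ v =
    if does (v ≟ᶠ y) then cy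
    else if does (v ≟ᶠ x) then xColour bP bQ
    else if does (v ∈? Pi) then greedyAlong bP Pi v
    else greedyAlong bQ Qi v

  module _ (cy bP bQ : Bool) where
    colour-y : colour cy bP bQ y ≡ cy
    colour-y with y ≟ᶠ y
    ... | yes _  = refl
    ... | no y≢y = ⊥-elim (y≢y refl)

    colour-x : colour cy bP bQ x ≡ xColour bP bQ
    colour-x with x ≟ᶠ y | x ≟ᶠ x
    ... | yes x≡y | _     = ⊥-elim (x≢y x≡y)
    ... | no _    | yes _ = refl
    ... | no _    | no x≢x = ⊥-elim (x≢x refl)

    colour-P : ∀ {v} → v ∈ Pi → colour cy bP bQ v ≡ greedyAlong bP Pi v
    colour-P {v} v∈Pi with v ≟ᶠ y | v ≟ᶠ x | v ∈? Pi
    ... | yes refl | _        | _      = ⊥-elim (y∉Pi v∈Pi)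
    ... | no _     | yes refl | _      = ⊥-elim (x∉Pi v∈Pi)
    ... | no _     | no _     | yes _  = refl
    ... | no _     | no _     | no v∉Pi = ⊥-elim (v∉Pi v∈Pi)

    colour-Q : ∀ {v} → v ∈ Qi → colour cy bP bQ v ≡ greedyAlong bQ Qi v
    colour-Q {v} v∈Qi with v ≟ᶠ y | v ≟ᶠ x | v ∈? Pi
    ... | yes refl | _        | _        = ⊥-elim (y∉Qi v∈Qi)
    ... | no _     | yes refl | _        = ⊥-elim (x∉Qi v∈Qi)
    ... | no _     | no _     | yes v∈Pi = ⊥-elim (disjoint v∈Pi v∈Qi)
    ... | no _     | no _     | no _     = refl

  onP : ∀ {w} → OnRoute y Pi x w → InTheta w
  onP (inj₁ w≡y)         = inj₁ w≡y
  onP (inj₂ (inj₁ w∈Pi)) = inj₂ (inj₂ (inj₁ w∈Pi))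
  onP (inj₂ (inj₂ w≡x))  = inj₂ (inj₁ w≡x)

  onQ : ∀ {w} → OnRoute y Qi x w → InTheta w
  onQ (inj₁ w≡y)         = inj₁ w≡y
  onQ (inj₂ (inj₁ w∈Qi)) = inj₂ (inj₂ (inj₂ w∈Qi))
  onQ (inj₂ (inj₂ w≡x))  = inj₂ (inj₁ w≡x)

  -- the conditions on (cy, bP, bQ) under which the colouring is good at x and y
  record Admissible (cy bP bQ : Bool) : Set where
    field
      startP  : bP ≡ true → cy ≡ true
      startQ  : bQ ≡ true → cy ≡ true
      yOut    : cy ≡ true → bP ≡ true ⊎ bQ ≡ true
      yIn     : cy ≡ false → R y ≡ true ⊎ xColour bP bQ ≡ true
      yForced : R y ≡ true → cy ≡ false
      xOut    : xColour bP bQ ≡ true → cy ≡ false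

  admissible-good : ∀ {cy bP bQ} → Admissible cy bP bQ → Good InTheta R (colour cy bP bQ)
  admissible-good {cy} {bP} {bQ} adm = good
    where
      open Admissible adm
      c : Colouring
      c = colour cy bP bQ

      atY : c y ≡ cy
      atY = colour-y cy bP bQ

      atX : c x ≡ xColour bP bQ
      atX = colour-x cy bP bQ

      greedyP : Greedy c bP Pi
      greedyP = Greedy-cong (colour-P cy bP bQ) (greedyAlong-greedy bP uniqueP)

      greedyQ : Greedy c bQ Qi
      greedyQ = Greedy-cong (colour-Q cy bP bQ) (greedyAlong-greedy bQ uniqueQ)

      backP : bP ≡ true → c y ≡ true
      backP = trans atY ∘ startP

      backQ : bQ ≡ true → c y ≡ true
      backQ = trans atY ∘ startQ

      exitP : exit bP Pi ≡ true → c x ≡ false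
      exitP e = trans atX (nor-right (R x) (cong (_∨ exit bQ Qi) e))

      exitQ : exit bQ Qi ≡ true → c x ≡ false
      exitQ e = trans atX (nor-right (R x) (trans (cong (exit bP Pi ∨_) e) (∨-zeroʳ _)))

      goodY : GoodAt InTheta R c y
      goodY = record
        { forced = λ Ry → trans atY (yForced Ry)
        ; outNbr = λ yTrue → successor (yOut (trans (sym atY) yTrue))
        ; inNbr  = λ yFalse → map₂ (λ xTrue → x , inj₂ (inj₁ refl) , trans atX xTrue , backArc)
                                   (yIn (trans (sym atY) yFalse))
        }
        where
          successor : bP ≡ true ⊎ bQ ≡ true → ∃[ w ] (InTheta w × c w ≡ false × Arc D y w)
          successor (inj₁ bP≡true) = let (w , onR , cw , yw) = firstOut routeP greedyP exitP bP≡true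
                                     in w , onP onR , cw , yw
          successor (inj₂ bQ≡true) = let (w , onR , cw , yw) = firstOut routeQ greedyQ exitQ bQ≡true
                                     in w , onQ onR , cw , yw

      goodX : GoodAt InTheta R c x
      goodX = record
        { forced = λ Rx → trans atX (nor-left _ Rx)
        ; outNbr = λ xTrue → y , inj₁ refl , trans atY (xOut (trans (sym atX) xTrue)) , backArc
        ; inNbr  = λ xFalse → predecessor (nor-false (R x) _ (trans (sym atX) xFalse))
        }
        where
          predecessor : R x ≡ true ⊎ exit bP Pi ∨ exit bQ Qi ≡ true →
            R x ≡ true ⊎ ∃[ u ] (InTheta u × c u ≡ true × Arc D u x)
          predecessor (inj₁ Rx) = inj₁ Rx
          predecessor (inj₂ e) with or-true (exit bP Pi) (exit bQ Qi) e
          ... | inj₁ eP = let (u , onR , cu , ux) = lastIn routeP greedyP backP eP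
                          in inj₂ (u , onP onR , cu , ux)
          ... | inj₂ eQ = let (u , onR , cu , ux) = lastIn routeQ greedyQ backQ eQ
                          in inj₂ (u , onQ onR , cu , ux)

      good : Good InTheta R c
      good _ (inj₁ refl)                = goodY
      good _ (inj₂ (inj₁ refl))         = goodX
      good _ (inj₂ (inj₂ (inj₁ v∈Pi))) = GoodAt-mono onP (internal routeP greedyP backP exitP v∈Pi)
      good _ (inj₂ (inj₂ (inj₂ v∈Qi))) = GoodAt-mono onQ (internal routeQ greedyQ backQ exitQ v∈Qi)

  -- Choice of (cy, bP, bQ): y goes to V₂ if prescribed or if x would be in V₁
  -- with both routes started after false; otherwise y is in V₁ and exactly one
  -- route starts after true, chosen so that x ends in V₂.
  admissible : ∃[ cy ] ∃[ bP ] ∃[ bQ ] Admissible cy bP bQ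
  admissible with R y in Ry | xColour false false in x₀ | exit false Pi in e₀
  ... | true | _ | _ = false , false , false , record
    { startP = λ (); startQ = λ (); yOut = λ ()
    ; yIn = λ _ → inj₁ Ry; yForced = λ _ → refl; xOut = λ _ → refl }
  ... | false | true | _ = false , false , false , record
    { startP = λ (); startQ = λ (); yOut = λ ()
    ; yIn = λ _ → inj₂ x₀; yForced = λ Ry' → ⊥-elim (clash Ry' Ry); xOut = λ _ → refl }
  ... | false | false | true = true , false , true , record
    { startP = λ (); startQ = λ _ → refl; yOut = λ _ → inj₂ refl
    ; yIn = λ (); yForced = λ Ry' → ⊥-elim (clash Ry' Ry)
    ; xOut = λ xTrue → ⊥-elim (clash xTrue (nor-right (R x) (cong (_∨ exit true Qi) e₀))) }
  ... | false | false | false = true , true , false , record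
    { startP = λ _ → refl; startQ = λ (); yOut = λ _ → inj₁ refl
    ; yIn = λ (); yForced = λ Ry' → ⊥-elim (clash Ry' Ry)
    ; xOut = λ xTrue → ⊥-elim (clash xTrue xInV₂) }
    where
      -- x₀ says R x or a route-exit is true; the exit along Pi is not
      xInV₂ : xColour true false ≡ false
      xInV₂ with nor-false (R x) _ x₀
      ... | inj₁ Rx = nor-left _ Rx
      ... | inj₂ e with or-true (exit false Pi) (exit false Qi) e
      ...   | inj₁ eP = ⊥-elim (clash eP e₀)
      ...   | inj₂ eQ = nor-right (R x) (trans (cong (exit true Pi ∨_) eQ) (∨-zeroʳ _))

thetaFlexible : ∀ {D} (Θ : Theta D) → Colourings.Flexible D (Theta.InTheta Θ)
thetaFlexible Θ R = let (cy , bP , bQ , adm) = admissible in colour cy bP bQ , admissible-good adm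
  where open ThetaColouring Θ R

walkRoute : ∀ {D : Digraph} {u z L} → Walk D (u ∷ L) → Unique (u ∷ L) → last (u ∷ L) ≡ just z →
  u ≢ z → ∃[ Li ] (Route D u Li z × Unique Li × z ∉ Li × (∀ {v} → v ∈ Li → v ∈ L))
walkRoute (single _) _ refl u≢z = ⊥-elim (u≢z refl)
walkRoute {z = z} (step {v = w} uw walk) (_ ∷ uniq@(w∉ws ∷ _)) lastL _ with w ≟ᶠ z
... | yes refl = [] , direct uw , [] , (λ ()) , (λ ())
... | no w≢z =
  let (Li , route , uniqueLi , z∉Li , Li⊆ws) = walkRoute walk uniq lastL w≢z
  in w ∷ Li , via uw route , All.tabulate (All.lookup w∉ws ∘ Li⊆ws) ∷ uniqueLi ,
     (λ { (here z≡w) → w≢z (sym z≡w) ; (there z∈Li) → z∉Li z∈Li }) ,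
     (λ { (here v≡w) → here v≡w ; (there v∈Li) → there (Li⊆ws v∈Li) })

pathRoute : ∀ {D : Digraph} {y x P} → IsPath D y x P → y ≢ x →
  ∃[ Li ] (Route D y Li x × Unique Li × y ∉ Li × x ∉ Li × (∀ {v} → v ∈ Li → v ∈ P))
pathRoute {P = []} (_ , _ , () , _)
pathRoute {P = _ ∷ _} (walk , uniq@(y∉L ∷ _) , refl , lastP) y≢x =
  let (Li , route , uniqueLi , x∉Li , Li⊆L) = walkRoute walk uniq lastP y≢x
  in Li , route , uniqueLi , (λ y∈Li → All.lookup y∉L (Li⊆L y∈Li) refl) , x∉Li , (there ∘ Li⊆L)

theta : ∀ {D : Digraph} {x y P Q} → Arc D x y → IsPath D y x P → IsPath D y x Q →
  InternallyDisjoint D y x P Q → Theta D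
theta {D} {x} {y} xy pathP pathQ internallyDisjoint
  with pathRoute pathP (≢-sym (arc-distinct D xy)) | pathRoute pathQ (≢-sym (arc-distinct D xy))
... | (Pi , routeP , uniqueP , y∉Pi , x∉Pi , Pi⊆P) | (Qi , routeQ , uniqueQ , y∉Qi , x∉Qi , Qi⊆Q) = record
  { x = x ; y = y ; backArc = xy ; Pi = Pi ; Qi = Qi ; routeP = routeP ; routeQ = routeQ
  ; uniqueP = uniqueP ; uniqueQ = uniqueQ ; y∉Pi = y∉Pi ; x∉Pi = x∉Pi ; y∉Qi = y∉Qi ; x∉Qi = x∉Qi
  ; disjoint = λ v∈Pi v∈Qi → onlyEnds v∈Pi (internallyDisjoint _ (Pi⊆P v∈Pi) (Qi⊆Q v∈Qi))
  }
  where
    onlyEnds : ∀ {v} → v ∈ Pi → v ≡ y ⊎ v ≡ x → ⊥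
    onlyEnds y∈Pi (inj₁ refl) = y∉Pi y∈Pi
    onlyEnds x∈Pi (inj₂ refl) = x∉Pi x∈Pi

-- A colouring of the whole digraph, good when nothing is prescribed, gives the
-- required 2-partition; both parts are non-empty since any vertex t has a
-- neighbour of the other colour.
partition : ∀ {D : Digraph} (t : V D) → ∃[ c ] Colourings.Good D (λ _ → ⊤) (λ _ → false) c →
  ∃[ c ] (Is2Partition D c
    × (∀ v → InV₁ {D} c v → ∃[ w ] (InV₂ {D} c w × Arc D v w))
    × (∀ v → InV₂ {D} c v → ∃[ u ] (InV₁ {D} c u × Arc D u v)))
partition {D} t (c , good) = c , bothParts , outNbrs , inNbrs
  where
    open Colourings D using (outNbr; inNbr)
    outNbrs : ∀ v → c v ≡ true → ∃[ w ] (c w ≡ false × Arc D v w)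
    outNbrs v cv = let (w , _ , cw , vw) = outNbr (good v tt) cv in w , cw , vw
    inNbrs : ∀ v → c v ≡ false → ∃[ u ] (c u ≡ true × Arc D u v)
    inNbrs v cv with inNbr (good v tt) cv
    ... | inj₁ ()
    ... | inj₂ (u , _ , cu , uv) = u , cu , uv
    bothParts : Is2Partition D c
    bothParts with c t in ct
    ... | true  = (t , ct) , (proj₁ (outNbrs t ct) , proj₁ (proj₂ (outNbrs t ct)))
    ... | false = (proj₁ (inNbrs t ct) , proj₁ (proj₂ (inNbrs t ct))) , (t , ct)

corollary5p4 : (D : Digraph) → Strong D →
    (x y : V D) → Arc D x y →
    (P Q : List (V D)) → IsPath D y x P → IsPath D y x Q → P ≢ Q →
    InternallyDisjoint D y x P Q →
    ∃[ c ] (Is2Partition D c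
      × (∀ v → InV₁ {D} c v → ∃[ w ] (InV₂ {D} c w × Arc D v w))
      × (∀ v → InV₂ {D} c v → ∃[ u ] (InV₁ {D} c u × Arc D u v)))
corollary5p4 D strong x y xy P Q pathP pathQ _ internallyDisjoint =
  partition x (everythingFlexible (λ _ → false))
  where
    Θ : Theta D
    Θ = theta xy pathP pathQ internallyDisjoint
    everythingFlexible : Colourings.Flexible D (λ _ → ⊤)
    everythingFlexible = Colourings.grow D strong (Theta.inTheta? Θ) (inj₂ (inj₁ refl)) (thetaFlexible Θ)
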